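{- For all $n \ge 1$ and all $k \ge 2$ there exists a bijection between $S_n(123, 132, (k-1)(k-2)\ldots 1\,k)$ and the set of tilings of a $1 \times n$ rectangle with tiles of sizes $1\times 1, 1\times 2, \ldots, 1\times (k-1)$.
   Context: Permutations of $[n]$ are written in one-line notation, and $S_n$ denotes the set of them. A permutation $\pi\in S_n$ contains $\sigma\in S_m$ if there are indices $i_1<\dots<i_m$ such that for all $a,b$, $\pi(i_a)<\pi(i_b)$ iff $\sigma(a)<\sigma(b)$; otherwise $\pi$ avoids $\sigma$. For a set $R$ of permutations, $S_n(R)$ is the set of $\pi\in S_n$ avoiding every element of $R$. The permutation $(k-1)(k-2)\ldots 1\,k\in S_k$ lists $k-1,\dots,1$ in decreasing order followed by $k$. -}

module Defs where

open import Data.Nat using (ℕ; zero; suc; _≤_; _∸_)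
open import Data.Fin using (Fin; inject₁; fromℕ)
import Data.Fin as Fin
open import Data.Vec using (Vec; []; _∷_; lookup; allFin; reverse; map; _∷ʳ_)
open import Data.List using (List)
open import Data.Nat.ListAction using (sum)
open import Data.List.Relation.Unary.All using (All)
open import Data.Product using (Σ; ∃; _×_)
open import Relation.Binary.PropositionalEquality using (_≡_)
open import Relation.Nullary using (¬_)
open import Function.Bundles using (_⇔_)
open import Data.Refinement using (Refinement-syntax)

-- A permutation of [n] in one-line notation: the vector (π(1), …, π(n)),
-- with values in Fin n (0-based), required to be injective (hence bijective).
IsPermutation : {n : ℕ} → Vec (Fin n) n → Set
IsPermutation {n} π = ∀ (i j : Fin n) → lookup π i ≡ lookup π j → i ≡ j

Contains : {n m : ℕ} → Vec (Fin n) n → Vec (Fin m) m → Set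
Contains {n} {m} π σ =
  Σ (Fin m → Fin n) λ f →
    (∀ a b → a Fin.< b → f a Fin.< f b) ×
    (∀ a b → (lookup π (f a) Fin.< lookup π (f b)) ⇔ (lookup σ a Fin.< lookup σ b))

Avoids : {n m : ℕ} → Vec (Fin n) n → Vec (Fin m) m → Set
Avoids π σ = ¬ Contains π σ

p123 : Vec (Fin 3) 3
p123 = Fin.zero ∷ Fin.suc Fin.zero ∷ Fin.suc (Fin.suc Fin.zero) ∷ []

p132 : Vec (Fin 3) 3
p132 = Fin.zero ∷ Fin.suc (Fin.suc Fin.zero) ∷ Fin.suc Fin.zero ∷ []

-- The pattern (k-1)(k-2)…1 k ∈ S_k (0-based: k-2, …, 0, k-1).
decThenMax : (k : ℕ) → Vec (Fin k) k
decThenMax zero = []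
decThenMax (suc m) = map inject₁ (reverse (allFin m)) ∷ʳ fromℕ m

-- S_n(123, 132, (k-1)…1 k), with irrelevant proofs so that equality is
-- equality of the underlying one-line notation.
AvoidSet : ℕ → ℕ → Set
AvoidSet n k =
  [ π ∈ Vec (Fin n) n ∣
    IsPermutation π × Avoids π p123 × Avoids π p132 × Avoids π (decThenMax k) ]

-- Tilings of a 1×n rectangle with tiles of sizes 1,…,k-1: the list of tile
-- lengths from left to right, each in [1, k-1], summing to n.
Tiling : ℕ → ℕ → Set
Tiling n k =
  [ ts ∈ List ℕ ∣ All (λ t → 1 ≤ t × t ≤ k ∸ 1) ts × sum ts ≡ n ]

-- An entry of a permutation avoiding 123 and 132 has at most one larger entry to
-- its right.  Let the maximum m of such a permutation of [0, m] sit at position e.  Every earlier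
-- entry already has the maximum as its larger entry to the right, so it exceeds all other later
-- entries; inductively the entries before e are m-1, m-2, …, m-e.  Hence π begins with a shifted
-- copy of the pattern e (e-1) … 1 (e+1) on its top e+1 values and continues with a permutation of
-- the same kind on the remaining values.  Avoiding (k-1)…1 k bounds these blocks by k-1, so the
-- block sizes form a tiling.  Conversely, in the permutation built from a tiling the only larger
-- entry right of any entry is the end of its block, which rules out all three patterns.  The tiling
-- is read back locally: position i ends a block iff i + π(i) ≥ n - 1.

module Submission where

open import Data.Empty using (⊥; ⊥-elim)
open import Data.Fin as F using (Fin; toℕ; fromℕ; fromℕ<; inject₁; opposite)
open import Data.Fin.Properties
  using (toℕ-injective; toℕ-fromℕ; toℕ-fromℕ<; fromℕ<-toℕ; toℕ-inject₁; toℕ<n; opposite-prop;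
         opposite-involutive; pigeonhole; punchOut-injective; any?)
import Data.Fin.Properties as Finₚ
open import Data.Irrelevant using ([_])
open import Data.List using (List; []; _∷_)
import Data.List.Properties as Listₚ
open import Data.List.Relation.Unary.All as All using (All; []; _∷_)
open import Data.Nat
  using (ℕ; zero; suc; _+_; _∸_; _≤_; _<_; z≤n; s≤s; z<s; s<s; s<s⁻¹; s≤s⁻¹; _≤?_; _<?_;
         compare; less; equal; greater)
open import Data.Nat.Induction using (<-rec; <-wellFounded)
open import Data.Nat.ListAction using (sum)
open import Data.Nat.Properties
open import Data.Nat.Tactic.RingSolver using (solve-∀)
open import Data.Product using (∃-syntax; _×_; _,_; proj₁; proj₂)
open import Data.Refinement using (_,_; value; value-injective)
open import Data.Vec using (Vec; []; _∷_; lookup; allFin; reverse; map; _∷ʳ_; tabulate)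
open import Data.Vec.Properties
  using (reverse-∷; lookup-map; lookup-allFin; lookup∘tabulate; tabulate∘lookup; tabulate-cong)
import Data.Vec.Properties as Vecₚ
open import Function using (_∘_)
open import Function.Bundles using (_⇔_; mk⇔; Equivalence; _⤖_; mk⤖)
open import Induction.WellFounded using (Acc; acc)
open import Relation.Binary.Definitions using (tri<; tri≈; tri>)
open import Relation.Binary.PropositionalEquality
open import Relation.Nullary using (¬_; yes; no)
open import Relation.Nullary.Decidable using (recompute)
open import Relation.Unary using (Decidable)

open import Defs

-- The permutation of a tiling

data TilePos (e : ℕ) : ℕ → Set where
  inside : ∀ {j} k → suc (j + k) ≡ e → TilePos e j
  end    : TilePos e e
  beyond : ∀ k → TilePos e (suc (e + k))

tilePos : ∀ e j → TilePos e j
tilePos e j with compare j e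
... | less    _ k = inside k refl
... | equal   _   = end
... | greater _ k = beyond k

-- A first tile of size suc e carries e-1, …, 0, e above the sum t values of the later tiles.
-- Tiles of size 0 never occur in a tiling and are skipped.
tilingPerm : List ℕ → ℕ → ℕ
tilingPerm []          i = 0
tilingPerm (zero ∷ t)  i = tilingPerm t i
tilingPerm (suc e ∷ t) i with tilePos e i
... | inside k _ = k + sum t
... | end        = e + sum t
... | beyond k   = tilingPerm t k

tileEnd : List ℕ → ℕ → ℕ
tileEnd []          i = i
tileEnd (zero ∷ t)  i = tileEnd t i
tileEnd (suc e ∷ t) i with tilePos e i
... | inside _ _ = e
... | end        = e
... | beyond k   = suc (e + tileEnd t k)

module _ {e : ℕ} {t : List ℕ} where

  tilingPerm-descent : ∀ {j} → j < e → suc (j + tilingPerm (suc e ∷ t) j) ≡ e + sum t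
  tilingPerm-descent {j} j<e with tilePos e j
  ... | inside k refl = sym (+-assoc (suc j) k (sum t))
  ... | end           = ⊥-elim (<-irrefl refl j<e)
  ... | beyond k      = ⊥-elim (<-asym j<e (s≤s (m≤m+n e k)))

  tilingPerm-top : ∀ {j} → j ≡ e → tilingPerm (suc e ∷ t) j ≡ e + sum t
  tilingPerm-top {j} j≡e with tilePos e j
  ... | inside k eq = ⊥-elim (m≢1+m+n e (trans (sym eq) (cong (λ x → suc (x + k)) j≡e)))
  ... | end         = refl
  ... | beyond k    = ⊥-elim (m≢1+m+n e (sym j≡e))

  tilingPerm-tail : ∀ {j} k → j ≡ suc (e + k) → tilingPerm (suc e ∷ t) j ≡ tilingPerm t k
  tilingPerm-tail {j} k j≡ with tilePos e j
  ... | inside k′ eq = ⊥-elim (<-asym (subst (j <_) eq (s≤s (m≤m+n j k′)))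
                                     (subst (e <_) (sym j≡) (s≤s (m≤m+n e k))))
  ... | end          = ⊥-elim (m≢1+m+n e j≡)
  ... | beyond k′    = cong (tilingPerm t) (+-cancelˡ-≡ e k′ k (suc-injective j≡))

tail-< : ∀ e t {k} → suc (e + k) < sum (suc e ∷ t) → k < sum t
tail-< e t = +-cancelˡ-< e _ _ ∘ s<s⁻¹

tilingPerm-< : ∀ {t i} → All (1 ≤_) t → i < sum t → tilingPerm t i < sum t
tilingPerm-< {suc e ∷ t} {i} (_ ∷ pos) i< with tilePos e i
... | inside k refl = +-monoˡ-< (sum t) (m<n⇒m<1+n (s≤s (m≤n+m k i)))
... | end           = n<1+n (i + sum t)
... | beyond k      = ≤-trans (tilingPerm-< pos (tail-< e t i<)) (m≤n+m (sum t) (suc e))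

tail<head : ∀ {t k} → All (1 ≤_) t → k < sum t → ∀ x → tilingPerm t k < x + sum t
tail<head pos k< x = <-≤-trans (tilingPerm-< pos k<) (m≤n+m _ x)

tilingPerm-injective : ∀ {t i l} → All (1 ≤_) t → i < sum t → l < sum t →
                       tilingPerm t i ≡ tilingPerm t l → i ≡ l
tilingPerm-injective {suc e ∷ t} {i} {l} (_ ∷ pos) i< l< eq with tilePos e i | tilePos e l
... | inside k refl | inside k′ eq′ =
  +-cancelʳ-≡ k i l (suc-injective (sym (trans (cong (λ x → suc (l + x)) k≡k′) eq′)))
  where k≡k′ = +-cancelʳ-≡ (sum t) k k′ eq
... | inside k refl | end            = ⊥-elim (m≢1+n+m k (+-cancelʳ-≡ (sum t) k _ eq))
... | end           | inside k′ refl = ⊥-elim (m≢1+n+m k′ (+-cancelʳ-≡ (sum t) k′ _ (sym eq)))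
... | end           | end            = refl
... | inside k _    | beyond k′      = ⊥-elim (<-irrefl (sym eq) (tail<head pos (tail-< e t l<) k))
... | end           | beyond k′      = ⊥-elim (<-irrefl (sym eq) (tail<head pos (tail-< e t l<) e))
... | beyond k      | inside k′ _    = ⊥-elim (<-irrefl eq (tail<head pos (tail-< e t i<) k′))
... | beyond k      | end            = ⊥-elim (<-irrefl eq (tail<head pos (tail-< e t i<) e))
... | beyond k      | beyond k′      =
  cong (suc ∘ (e +_)) (tilingPerm-injective pos (tail-< e t i<) (tail-< e t l<) eq)

larger-after⇒tileEnd : ∀ {t i l} → All (1 ≤_) t → i < l → l < sum t →
                       tilingPerm t i < tilingPerm t l → l ≡ tileEnd t i
larger-after⇒tileEnd {suc e ∷ t} {i} {l} (_ ∷ pos) i<l l< lt with tilePos e i | tilePos e l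
... | inside k refl | inside k′ eq′ = ⊥-elim (<-asym (+-cancelʳ-< (sum t) k k′ lt) k′<k)
  where
    k′<k : k′ < k
    k′<k = +-cancelˡ-< i k′ k (subst (i + k′ <_) (suc-injective eq′) (+-monoˡ-< k′ i<l))
... | inside k _    | end       = refl
... | inside k _    | beyond k′ = ⊥-elim (<-asym lt (tail<head pos (tail-< e t l<) k))
... | end           | inside k′ refl = ⊥-elim (<-asym i<l (s≤s (m≤m+n l k′)))
... | end           | end       = ⊥-elim (<-irrefl refl i<l)
... | end           | beyond k′ = ⊥-elim (<-asym lt (tail<head pos (tail-< e t l<) e))
... | beyond k      | inside k′ eq′ =
  ⊥-elim (<-asym (<-trans (s≤s (m≤m+n e k)) i<l) (subst (l <_) eq′ (s≤s (m≤m+n l k′))))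
... | beyond k      | end       = ⊥-elim (<-asym i<l (s≤s (m≤m+n e k)))
... | beyond k      | beyond k′ =
  cong (suc ∘ (e +_)) (larger-after⇒tileEnd pos (+-cancelˡ-< e k k′ (s<s⁻¹ i<l)) (tail-< e t l<) lt)

tileEnd-< : ∀ {K t i} → All (_≤ K) t → i < sum t → tileEnd t i < i + K
tileEnd-< {t = zero ∷ t}  (_ ∷ small) i< = tileEnd-< small i<
tileEnd-< {K} {suc e ∷ t} {i} (e<K ∷ small) i< with tilePos e i
... | inside k refl = <-≤-trans e<K (m≤n+m K i)
... | end           = m<m+n i (<-≤-trans (s≤s z≤n) e<K)
... | beyond k      =
  s≤s (≤-trans (+-monoʳ-< e (tileEnd-< small (tail-< e t i<))) (≤-reflexive (sym (+-assoc e k K))))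

-- Reading the tiling back

module _ {P : ℕ → Set} (P? : Decidable P) where

  runLengths : (i r k : ℕ) → List ℕ
  runLengths i zero    k = []
  runLengths i (suc r) k with P? i
  ... | yes _ = suc k ∷ runLengths (suc i) r 0
  ... | no  _ = runLengths (suc i) r (suc k)

  runLengths-run : ∀ d {i r k} → (∀ {j} → j < d → ¬ P (i + j)) → P (i + d) →
                   runLengths i (suc (d + r)) k ≡ suc (d + k) ∷ runLengths (suc (i + d)) r 0
  runLengths-run zero {i} {r} {k} _ Pi+0 with P? i
  ... | yes _  = cong (λ x → suc k ∷ runLengths (suc x) r 0) (sym (+-identityʳ i))
  ... | no ¬Pi = ⊥-elim (¬Pi (subst P (+-identityʳ i) Pi+0))
  runLengths-run (suc d) {i} {r} {k} ¬P Pi+d with P? i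
  ... | yes Pi = ⊥-elim (¬P z<s (subst P (sym (+-identityʳ i)) Pi))
  ... | no  _  = trans (runLengths-run d (λ j<d → ¬P (s<s j<d) ∘ subst P (sym (+-suc i _)))
                                         (subst P (+-suc i d) Pi+d))
                       (cong₂ (λ x y → suc x ∷ runLengths (suc y) r 0) (+-suc d k) (sym (+-suc i d)))

-- In the permutation of a tiling of n cells, j + p j = n - 2 inside a tile and j + p j ≥ n - 1
-- at its last cell.
EndsTile : (ℕ → ℕ) → ℕ → ℕ → Set
EndsTile p n j = n ≤ suc (j + p j)

endsTile? : ∀ p n → Decidable (EndsTile p n)
endsTile? p n j = n ≤? suc (j + p j)

decode : (ℕ → ℕ) → ℕ → List ℕ
decode p n = runLengths (endsTile? p n) 0 n 0

suc-+-assoc : ∀ a b c → suc (a + b) + c ≡ a + suc (b + c)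
suc-+-assoc = solve-∀

decode-tilingPerm : ∀ {p n s t} → All (1 ≤_) t → s + sum t ≡ n →
                    (∀ {i} → i < sum t → p (s + i) ≡ tilingPerm t i) →
                    runLengths (endsTile? p n) s (sum t) 0 ≡ t
decode-tilingPerm {t = []} _ _ _ = refl
decode-tilingPerm {p} {n} {s} {suc e ∷ t} (_ ∷ pos) s+sum≡n agree =
  trans (runLengths-run (endsTile? p n) e notEnd isEnd)
        (cong₂ _∷_ (cong suc (+-identityʳ e)) (decode-tilingPerm pos s′+S≡n agree′))
  where
    S = sum t
    s′ = suc (s + e)
    shifted : ∀ {j} → j < suc (e + S) → suc (s + j + p (s + j)) ≡ s + suc (j + tilingPerm (suc e ∷ t) j)
    shifted {j} j< = trans (cong (λ x → suc (s + j + x)) (agree j<)) (suc-+-assoc s j _)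
    notEnd : ∀ {j} → j < e → ¬ EndsTile p n (s + j)
    notEnd {j} j<e ended = <-irrefl refl (≤-<-trans ended (begin-strict
      suc (s + j + p (s + j))  ≡⟨ shifted (<-≤-trans j<e (≤-trans (m≤m+n e S) (n≤1+n _))) ⟩
      s + suc (j + tilingPerm (suc e ∷ t) j) ≡⟨ cong (s +_) (tilingPerm-descent {e} {t} j<e) ⟩
      s + (e + S)              <⟨ +-monoʳ-< s (n<1+n _) ⟩
      s + suc (e + S)          ≡⟨ s+sum≡n ⟩
      n                        ∎))
      where open ≤-Reasoning
    isEnd : EndsTile p n (s + e)
    isEnd = begin
      n                          ≡⟨ s+sum≡n ⟨
      s + suc (e + S)            ≤⟨ +-monoʳ-≤ s (s≤s (m≤n+m (e + S) e)) ⟩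
      s + suc (e + (e + S))      ≡⟨ cong (λ x → s + suc (e + x)) (tilingPerm-top {e} {t} refl) ⟨
      s + suc (e + tilingPerm (suc e ∷ t) e) ≡⟨ shifted (s≤s (m≤m+n e S)) ⟨
      suc (s + e + p (s + e))    ∎
      where open ≤-Reasoning
    s′+S≡n : s′ + S ≡ n
    s′+S≡n = trans (suc-+-assoc s e S) s+sum≡n
    agree′ : ∀ {i} → i < S → p (s′ + i) ≡ tilingPerm t i
    agree′ {i} i<S = begin
      p (s′ + i)                             ≡⟨ cong p (suc-+-assoc s e i) ⟩
      p (s + suc (e + i))                    ≡⟨ agree (s≤s (+-monoʳ-< e i<S)) ⟩
      tilingPerm (suc e ∷ t) (suc (e + i))   ≡⟨ tilingPerm-tail {e} {t} i refl ⟩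
      tilingPerm t i                         ∎
      where open ≡-Reasoning

-- Permutations avoiding the patterns split into blocks

complement-unique : ∀ {a b c m} → suc (a + b) ≡ m → suc (c + a) ≡ m → b ≡ c
complement-unique {a} {b} {c} a+b+1≡m c+a+1≡m =
  +-cancelˡ-≡ a b c (suc-injective (trans a+b+1≡m (trans (sym c+a+1≡m) (cong suc (+-comm c a)))))

TileSizes : ℕ → List ℕ → Set
TileSizes K = All (λ d → 1 ≤ d × d ≤ K)

IsTilingPermOn : ℕ → (ℕ → ℕ) → ℕ → ℕ → Set
IsTilingPermOn K p s m =
  ∃[ t ] TileSizes K t × sum t ≡ m × (∀ {i} → i < m → p (s + i) ≡ tilingPerm t i)

InjectiveBelow : ℕ → (ℕ → ℕ) → Set
InjectiveBelow n p = ∀ {i j} → i < n → j < n → p i ≡ p j → i ≡ j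

AtMostOneLargerAfter : ℕ → (ℕ → ℕ) → Set
AtMostOneLargerAfter n p = ∀ {i j l} → i < j → j < l → l < n → p i < p j → p i < p l → ⊥

-- p (s + q) = c - 1 - q for q < K: a run c-1, …, c-K, followed later by c.
NoTopAfterRun : ℕ → ℕ → (ℕ → ℕ) → Set
NoTopAfterRun K n p =
  ∀ {s l c} → s + K ≤ l → l < n → (∀ {q} → q < K → suc (q + p (s + q)) ≡ c) → p l ≢ c

record IsSegmentPermutation (p : ℕ → ℕ) (s m : ℕ) : Set where
  field
    bounded : ∀ {i} → i < m → p (s + i) < m
    onto    : ∀ {v} → v < m → ∃[ i ] i < m × p (s + i) ≡ v

module Structure {K n : ℕ} {p : ℕ → ℕ} (inj : InjectiveBelow n p)
                 (oneLarger : AtMostOneLargerAfter n p) (noRun : NoTopAfterRun K n p) where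

  module Block {s m : ℕ} (s+m≡n : s + suc m ≡ n) (seg : IsSegmentPermutation p s (suc m)) where
    open IsSegmentPermutation seg

    inSegment : ∀ {i} → i < suc m → s + i < n
    inSegment i< = <-≤-trans (+-monoʳ-< s i<) (≤-reflexive s+m≡n)

    injective : ∀ {i j} → i < suc m → j < suc m → p (s + i) ≡ p (s + j) → i ≡ j
    injective i< j< eq = +-cancelˡ-≡ s _ _ (inj (inSegment i<) (inSegment j<) eq)

    twoLarger : ∀ {q r l} → q < r → q < l → r ≢ l → r < suc m → l < suc m →
                p (s + q) < p (s + r) → p (s + q) < p (s + l) → ⊥
    twoLarger {q} {r} {l} q<r q<l r≢l r< l< qr ql with <-cmp r l
    ... | tri< r<l _ _ = oneLarger (+-monoʳ-< s q<r) (+-monoʳ-< s r<l) (inSegment l<) qr ql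
    ... | tri≈ _ r≡l _ = r≢l r≡l
    ... | tri> _ _ l<r = oneLarger (+-monoʳ-< s q<l) (+-monoʳ-< s l<r) (inSegment r<) ql qr

    e : ℕ
    e = proj₁ (onto (n<1+n m))

    e<suc-m : e < suc m
    e<suc-m = proj₁ (proj₂ (onto (n<1+n m)))

    p[e]≡m : p (s + e) ≡ m
    p[e]≡m = proj₂ (proj₂ (onto (n<1+n m)))

    below-top : ∀ {q} → q < suc m → q ≢ e → p (s + q) < m
    below-top q< q≢e =
      ≤∧≢⇒< (s≤s⁻¹ (bounded q<)) (λ eq → q≢e (injective q< e<suc-m (trans eq (sym p[e]≡m))))

    -- A larger value at q would already occur left of q by induction; a smaller one would leave
    -- m-1-q to the right of q, a second larger entry besides the maximum.
    module BeforeTop {q} (q<e : q < e) (ih : ∀ {q′} → q′ < q → q′ < e → suc (q′ + p (s + q′)) ≡ m) where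
      q<suc-m : q < suc m
      q<suc-m = <-trans q<e e<suc-m

      v = p (s + q)

      not-above : ¬ (m < suc (q + v))
      not-above m<  with m≤n⇒∃[o]m+o≡n (below-top q<suc-m (<⇒≢ q<e))
      ... | q′ , m≡ = <-irrefl (injective (<-trans q′<q q<suc-m) q<suc-m same) q′<q
        where
          q′<q : q′ < q
          q′<q = +-cancelˡ-< v q′ q
                   (subst (v + q′ <_) (+-comm q v) (s<s⁻¹ (subst (_< suc (q + v)) (sym m≡) m<)))
          same : p (s + q′) ≡ v
          same = complement-unique (ih q′<q (<-trans q′<q q<e)) m≡

      not-below : ¬ (suc (q + v) < m)
      not-below <m with m≤n⇒∃[o]m+o≡n (<-≤-trans q<e (s≤s⁻¹ e<suc-m))
      ... | w , m≡ with onto (s≤s (≤-trans (m≤n+m w q) (≤-trans (n≤1+n _) (≤-reflexive m≡))))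
      ... | r , r< , p[r]≡w =
        twoLarger q<r q<e r≢e r< e<suc-m (subst (v <_) (sym p[r]≡w) v<w) (subst (v <_) (sym p[e]≡m) v<m)
        where
          v<w : v < w
          v<w = +-cancelˡ-< q v w (s<s⁻¹ {q + v} {q + w} (subst (suc (q + v) <_) (sym m≡) <m))
          v<m : v < m
          v<m = ≤-<-trans (m≤n+m v q) (<-trans (n<1+n _) <m)
          r≢e : r ≢ e
          r≢e refl = <-irrefl (trans (sym p[r]≡w) p[e]≡m) (≤-trans (s≤s (m≤n+m w q)) (≤-reflexive m≡))
          q<r : q < r
          q<r with <-cmp q r
          ... | tri< q<r _ _ = q<r
          ... | tri≈ _ refl _ = ⊥-elim (<-irrefl p[r]≡w v<w)
          ... | tri> _ _ r<q =
            ⊥-elim (<-irrefl (+-cancelʳ-≡ w r q (suc-injective (trans r+w+1≡m (sym m≡)))) r<q)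
            where
              r+w+1≡m : suc (r + w) ≡ m
              r+w+1≡m = subst (λ x → suc (r + x) ≡ m) p[r]≡w (ih r<q (<-trans r<q q<e))

    before-top : ∀ {q} → q < e → suc (q + p (s + q)) ≡ m
    before-top {q} = <-rec (λ q → q < e → suc (q + p (s + q)) ≡ m) step q
      where
        step : ∀ q → (∀ {q′} → q′ < q → q′ < e → suc (q′ + p (s + q′)) ≡ m) →
               q < e → suc (q + p (s + q)) ≡ m
        step q ih q<e with <-cmp (suc (q + p (s + q))) m
        ... | tri< below _ _ = ⊥-elim (BeforeTop.not-below q<e ih below)
        ... | tri≈ _ exact _ = exact
        ... | tri> _ _ above = ⊥-elim (BeforeTop.not-above q<e ih above)

    e<K : e < K
    e<K = ≰⇒> λ K≤e → noRun (+-monoʳ-≤ s K≤e) (inSegment e<suc-m)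
                            (λ q<K → before-top (<-≤-trans q<K K≤e)) p[e]≡m

    r : ℕ
    r = proj₁ (m≤n⇒∃[o]m+o≡n (s≤s⁻¹ e<suc-m))

    e+r≡m : e + r ≡ m
    e+r≡m = proj₂ (m≤n⇒∃[o]m+o≡n (s≤s⁻¹ e<suc-m))

    r≤m : r ≤ m
    r≤m = ≤-trans (m≤n+m r e) (≤-reflexive e+r≡m)

    small⇒after-top : ∀ {j} → j < suc m → p (s + j) < r → e < j
    small⇒after-top {j} j< small with <-cmp j e
    ... | tri< j<e _ _ = ⊥-elim (<-irrefl (before-top j<e) (begin-strict
          suc j + p (s + j) <⟨ +-mono-≤-< j<e small ⟩
          e + r             ≡⟨ e+r≡m ⟩
          m                 ∎))
      where open ≤-Reasoning
    ... | tri≈ _ refl _ = ⊥-elim (<-irrefl p[e]≡m (<-≤-trans small r≤m))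
    ... | tri> _ _ e<j = e<j

    after-top⇒small : ∀ {j} → j < suc m → e < j → p (s + j) < r
    after-top⇒small {j} j< e<j = ≰⇒> large⇒⊥
      where
        v = p (s + j)
        large⇒⊥ : ¬ (r ≤ v)
        large⇒⊥ r≤v with m≤n⇒∃[o]m+o≡n (below-top j< (<⇒≢ e<j ∘ sym))
        ... | q′ , m≡ = <-irrefl (injective (<-trans q′<e e<suc-m) j< same) (<-trans q′<e e<j)
          where
            q′<e : q′ < e
            q′<e = +-cancelʳ-≤ r (suc q′) e (begin
              suc q′ + r  ≤⟨ s≤s (+-monoʳ-≤ q′ r≤v) ⟩
              suc q′ + v  ≡⟨ cong suc (+-comm q′ v) ⟩
              suc v + q′  ≡⟨ m≡ ⟩
              m           ≡⟨ e+r≡m ⟨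
              e + r       ∎)
              where open ≤-Reasoning
            same : p (s + q′) ≡ v
            same = complement-unique (before-top q′<e) m≡

    s′ : ℕ
    s′ = s + suc e

    s′+r≡n : s′ + r ≡ n
    s′+r≡n = trans (+-assoc s (suc e) r) (trans (cong (λ x → s + suc x) e+r≡m) s+m≡n)

    rest : IsSegmentPermutation p s′ r
    rest = record { bounded = bounded′ ; onto = onto′ }
      where
        bounded′ : ∀ {i} → i < r → p (s′ + i) < r
        bounded′ {i} i<r = subst (_< r) (cong p (sym (+-assoc s (suc e) i)))
          (after-top⇒small (s≤s (≤-trans (+-monoʳ-< e i<r) (≤-reflexive e+r≡m))) (s≤s (m≤m+n e i)))
        onto′ : ∀ {v} → v < r → ∃[ i ] i < r × p (s′ + i) ≡ v
        onto′ v<r with onto (≤-trans v<r (≤-trans (m≤n+m r e) (≤-trans (≤-reflexive e+r≡m) (n≤1+n m))))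
        ... | j , j< , p[j]≡v with m≤n⇒∃[o]m+o≡n (small⇒after-top j< (subst (_< r) (sym p[j]≡v) v<r))
        ... | i , refl = i , +-cancelˡ-< (suc e) i r (≤-trans j< (≤-reflexive (cong suc (sym e+r≡m))))
                           , trans (cong p (+-assoc s (suc e) i)) p[j]≡v

    extend : IsTilingPermOn K p s′ r → IsTilingPermOn K p s (suc m)
    extend (t , sizes , sum≡r , agree) = suc e ∷ t , (s≤s z≤n , e<K) ∷ sizes , sum≡ , agree′
      where
        sum≡ : suc e + sum t ≡ suc m
        sum≡ = cong suc (trans (cong (e +_) sum≡r) e+r≡m)
        agree′ : ∀ {i} → i < suc m → p (s + i) ≡ tilingPerm (suc e ∷ t) i
        agree′ {i} i< with tilePos e i
        ... | inside k e≡ = +-cancelˡ-≡ (suc i) _ _ (begin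
              suc i + p (s + i)   ≡⟨ before-top (subst (i <_) e≡ (s≤s (m≤m+n i k))) ⟩
              m                   ≡⟨ e+r≡m ⟨
              e + r               ≡⟨ cong₂ _+_ e≡ sum≡r ⟨
              suc (i + k) + sum t ≡⟨ cong suc (+-assoc i k (sum t)) ⟩
              suc i + (k + sum t) ∎)
          where open ≡-Reasoning
        ... | end = trans p[e]≡m (trans (sym e+r≡m) (cong (e +_) (sym sum≡r)))
        ... | beyond k = trans (cong p (sym (+-assoc s (suc e) k)))
                  (agree (subst (k <_) sum≡r (tail-< e t (subst (suc (e + k) <_) (sym sum≡) i<))))

  decompose : ∀ {s m} → Acc _<_ m → s + m ≡ n → IsSegmentPermutation p s m → IsTilingPermOn K p s m
  decompose {m = zero}  _        _     _   = [] , [] , refl , λ ()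
  decompose {m = suc m} (acc rs) s+m≡n seg = extend (decompose (rs r<suc-m) s′+r≡n rest)
    where
      open Block s+m≡n seg
      r<suc-m : r < suc m
      r<suc-m = s≤s (≤-trans (m≤n+m r e) (≤-reflexive e+r≡m))

-- One-line notation

lookup-∷ʳ-inject₁ : ∀ {A : Set} {n} (xs : Vec A n) x (j : Fin n) →
                    lookup (xs ∷ʳ x) (inject₁ j) ≡ lookup xs j
lookup-∷ʳ-inject₁ (y ∷ ys) x F.zero    = refl
lookup-∷ʳ-inject₁ (y ∷ ys) x (F.suc j) = lookup-∷ʳ-inject₁ ys x j

lookup-∷ʳ-last : ∀ {A : Set} {n} (xs : Vec A n) x → lookup (xs ∷ʳ x) (fromℕ n) ≡ x
lookup-∷ʳ-last []       x = refl
lookup-∷ʳ-last (y ∷ ys) x = lookup-∷ʳ-last ys x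

lookup-reverse-opposite : ∀ {A : Set} {n} (xs : Vec A n) (i : Fin n) →
                          lookup (reverse xs) (opposite i) ≡ lookup xs i
lookup-reverse-opposite (y ∷ ys) F.zero    rewrite reverse-∷ y ys = lookup-∷ʳ-last (reverse ys) y
lookup-reverse-opposite (y ∷ ys) (F.suc i) rewrite reverse-∷ y ys =
  trans (lookup-∷ʳ-inject₁ (reverse ys) y (opposite i)) (lookup-reverse-opposite ys i)

lookup-reverse : ∀ {A : Set} {n} (xs : Vec A n) (i : Fin n) → lookup (reverse xs) i ≡ lookup xs (opposite i)
lookup-reverse xs i =
  trans (cong (lookup (reverse xs)) (sym (opposite-involutive i))) (lookup-reverse-opposite xs (opposite i))

toℕ-lookup-decThenMax-last : ∀ K → toℕ (lookup (decThenMax (suc K)) (fromℕ K)) ≡ K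
toℕ-lookup-decThenMax-last K =
  trans (cong toℕ (lookup-∷ʳ-last (map inject₁ (reverse (allFin K))) (fromℕ K))) (toℕ-fromℕ K)

toℕ-lookup-decThenMax-inject₁ : ∀ K (j : Fin K) →
                                toℕ (lookup (decThenMax (suc K)) (inject₁ j)) ≡ K ∸ suc (toℕ j)
toℕ-lookup-decThenMax-inject₁ K j = begin
  toℕ (lookup (decThenMax (suc K)) (inject₁ j))
    ≡⟨ cong toℕ (lookup-∷ʳ-inject₁ (map inject₁ rev) (fromℕ K) j) ⟩
  toℕ (lookup (map inject₁ rev) j)              ≡⟨ cong toℕ (lookup-map j inject₁ rev) ⟩
  toℕ (inject₁ (lookup rev j))                  ≡⟨ toℕ-inject₁ _ ⟩
  toℕ (lookup rev j)                            ≡⟨ cong toℕ (lookup-reverse (allFin K) j) ⟩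
  toℕ (lookup (allFin K) (opposite j))          ≡⟨ cong toℕ (lookup-allFin (opposite j)) ⟩
  toℕ (opposite j)                              ≡⟨ opposite-prop j ⟩
  K ∸ suc (toℕ j)                               ∎
  where
    open ≡-Reasoning
    rev = reverse (allFin K)

StrictlyIncreasing : ∀ {m} → (Fin m → ℕ) → Set
StrictlyIncreasing g = ∀ a b → a F.< b → g a < g b

increasing⇒spread : ∀ {m} (g : Fin (suc m) → ℕ) → StrictlyIncreasing g → ∀ a → g F.zero + toℕ a ≤ g a
increasing⇒spread g inc F.zero    = ≤-reflexive (+-identityʳ _)
increasing⇒spread {suc m} g inc (F.suc a) = begin
  g F.zero + suc (toℕ a)    ≡⟨ +-suc _ _ ⟩
  suc (g F.zero) + toℕ a    ≤⟨ +-monoˡ-≤ (toℕ a) (inc F.zero (F.suc F.zero) z<s) ⟩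
  g (F.suc F.zero) + toℕ a  ≤⟨ increasing⇒spread (g ∘ F.suc) (λ a b → inc (F.suc a) (F.suc b) ∘ s<s) a ⟩
  g (F.suc a)               ∎
  where open ≤-Reasoning

lookup₃-increasing : ∀ {x y z} → x < y → y < z → StrictlyIncreasing (lookup (x ∷ y ∷ z ∷ []))
lookup₃-increasing x<y y<z F.zero           (F.suc F.zero)           _ = x<y
lookup₃-increasing x<y y<z F.zero           (F.suc (F.suc F.zero))   _ = <-trans x<y y<z
lookup₃-increasing x<y y<z (F.suc F.zero)   (F.suc (F.suc F.zero))   _ = y<z
lookup₃-increasing x<y y<z (F.suc F.zero)   (F.suc F.zero)           (s≤s ())
lookup₃-increasing x<y y<z (F.suc (F.suc F.zero)) (F.suc (F.suc F.zero)) (s≤s (s≤s ()))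

data LastView {n : ℕ} : Fin (suc n) → Set where
  last   : LastView (fromℕ n)
  inject : (j : Fin n) → LastView (inject₁ j)

lastView : ∀ {n} (i : Fin (suc n)) → LastView i
lastView {zero}  F.zero    = last
lastView {suc n} F.zero    = inject F.zero
lastView {suc n} (F.suc i) with lastView i
... | last     = last
... | inject j = inject (F.suc j)

injective⇒surjective : ∀ {n} (g : Fin n → Fin n) → (∀ x y → g x ≡ g y → x ≡ y) → ∀ v → ∃[ x ] g x ≡ v
injective⇒surjective {suc n} g inj v with any? (λ x → g x F.≟ v)
... | yes found = found
... | no missed with pigeonhole (n<1+n n) (λ x → F.punchOut {i = v} {j = g x} (missed ∘ (x ,_) ∘ sym))
... | i , j , i<j , eq = ⊥-elim (<-irrefl (cong toℕ (inj i j i≡j)) i<j)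
  where i≡j = punchOut-injective {i = v} (missed ∘ (i ,_) ∘ sym) (missed ∘ (j ,_) ∘ sym) eq

toFun : ∀ {n} → Vec (Fin n) n → ℕ → ℕ
toFun {n} π i with i <? n
... | yes i<n = toℕ (lookup π (fromℕ< i<n))
... | no  _   = 0

toFun-< : ∀ {n} (π : Vec (Fin n) n) {i} (i<n : i < n) → toFun π i ≡ toℕ (lookup π (fromℕ< i<n))
toFun-< {n} π {i} i<n with i <? n
... | yes _   = refl
... | no  i≮n = ⊥-elim (i≮n i<n)

toFun-toℕ : ∀ {n} (π : Vec (Fin n) n) (x : Fin n) → toFun π (toℕ x) ≡ toℕ (lookup π x)
toFun-toℕ π x = trans (toFun-< π (toℕ<n x)) (cong (toℕ ∘ lookup π) (fromℕ<-toℕ x (toℕ<n x)))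

fromℕ-or : ∀ {n} → ℕ → Fin n → Fin n
fromℕ-or {n} v d with v <? n
... | yes v<n = fromℕ< v<n
... | no  _   = d

toℕ-fromℕ-or : ∀ {n v} (d : Fin n) → v < n → toℕ (fromℕ-or v d) ≡ v
toℕ-fromℕ-or {n} {v} d v<n with v <? n
... | yes v<n′ = toℕ-fromℕ< v<n′
... | no  v≮n  = ⊥-elim (v≮n v<n)

fromTiling : ∀ n → List ℕ → Vec (Fin n) n
fromTiling n t = tabulate (λ x → fromℕ-or (tilingPerm t (toℕ x)) x)

embedding⇒contains : ∀ {n m} (π : Vec (Fin n) n) (σ : Vec (Fin m) m) (f h : Fin m → ℕ) →
                     (∀ a → f a < n) → StrictlyIncreasing f → StrictlyIncreasing h →
                     (∀ a → toFun π (f a) ≡ h (lookup σ a)) → Contains π σ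
embedding⇒contains {m = m} π σ f h f<n f-inc h-inc agree = F , F-inc , order
  where
    F : Fin m → Fin _
    F a = fromℕ< (f<n a)
    F-inc : ∀ a b → a F.< b → F a F.< F b
    F-inc a b a<b = subst₂ _<_ (sym (toℕ-fromℕ< (f<n a))) (sym (toℕ-fromℕ< (f<n b))) (f-inc a b a<b)
    πF≡h : ∀ a → toℕ (lookup π (F a)) ≡ h (lookup σ a)
    πF≡h a = trans (sym (toFun-< π (f<n a))) (agree a)
    h-reflects : ∀ {x y} → h x < h y → x F.< y
    h-reflects {x} {y} hx<hy with Finₚ.<-cmp x y
    ... | tri< x<y _ _ = x<y
    ... | tri≈ _ refl _ = ⊥-elim (<-irrefl refl hx<hy)
    ... | tri> _ _ y<x = ⊥-elim (<-asym hx<hy (h-inc y x y<x))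
    order : ∀ a b → (lookup π (F a) F.< lookup π (F b)) ⇔ (lookup σ a F.< lookup σ b)
    order a b = mk⇔ (h-reflects ∘ subst₂ _<_ (πF≡h a) (πF≡h b))
                    (subst₂ _<_ (sym (πF≡h a)) (sym (πF≡h b)) ∘ h-inc _ _)

module FromTiling {n t} (pos : All (1 ≤_) t) (sum≡n : sum t ≡ n) where

  toℕ-lookup-fromTiling : ∀ x → toℕ (lookup (fromTiling n t) x) ≡ tilingPerm t (toℕ x)
  toℕ-lookup-fromTiling x = trans (cong toℕ (lookup∘tabulate _ x))
    (toℕ-fromℕ-or x (subst (tilingPerm t (toℕ x) <_) sum≡n
                       (tilingPerm-< pos (subst (toℕ x <_) (sym sum≡n) (toℕ<n x)))))

  toFun-fromTiling : ∀ {i} → i < sum t → toFun (fromTiling n t) i ≡ tilingPerm t i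
  toFun-fromTiling {i} i< = trans (toFun-< _ i<n)
    (trans (toℕ-lookup-fromTiling (fromℕ< i<n)) (cong (tilingPerm t) (toℕ-fromℕ< i<n)))
    where i<n = subst (i <_) sum≡n i<

  decode-fromTiling : decode (toFun (fromTiling n t)) n ≡ t
  decode-fromTiling = subst (λ m → runLengths (endsTile? p n) 0 m 0 ≡ t) sum≡n
                            (decode-tilingPerm {p} pos sum≡n toFun-fromTiling)
    where p = toFun (fromTiling n t)

  bounded : ∀ (x : Fin n) → toℕ x < sum t
  bounded x = subst (toℕ x <_) (sym sum≡n) (toℕ<n x)

  isPermutation : IsPermutation (fromTiling n t)
  isPermutation x y eq = toℕ-injective (tilingPerm-injective pos (bounded x) (bounded y)
    (trans (sym (toℕ-lookup-fromTiling x)) (trans (cong toℕ eq) (toℕ-lookup-fromTiling y))))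

  larger-after : ∀ {x y} → x F.< y → lookup (fromTiling n t) x F.< lookup (fromTiling n t) y →
                 toℕ y ≡ tileEnd t (toℕ x)
  larger-after {x} {y} x<y lt = larger-after⇒tileEnd pos x<y (bounded y)
    (subst₂ _<_ (toℕ-lookup-fromTiling x) (toℕ-lookup-fromTiling y) lt)

  avoids-firstSmallest : (σ : Vec (Fin 3) 3) → lookup σ F.zero F.< lookup σ (F.suc F.zero) →
                         lookup σ F.zero F.< lookup σ (F.suc (F.suc F.zero)) → Avoids (fromTiling n t) σ
  avoids-firstSmallest σ σ₀<σ₁ σ₀<σ₂ (f , inc , order) =
    <-irrefl (trans (larger-after (inc _ _ z<s) (Equivalence.from (order _ _) σ₀<σ₁))
                    (sym (larger-after (inc _ _ z<s) (Equivalence.from (order _ _) σ₀<σ₂))))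
             (inc (F.suc F.zero) (F.suc (F.suc F.zero)) (s<s z<s))

  avoids-decThenMax : ∀ {L} → 0 < L → All (_≤ L) t → Avoids (fromTiling n t) (decThenMax (suc L))
  avoids-decThenMax {L@(suc K)} 0<L small (f , inc , order) = <-irrefl refl (begin-strict
    toℕ (f F.zero) + L             ≡⟨ cong (toℕ (f F.zero) +_) (toℕ-fromℕ L) ⟨
    toℕ (f F.zero) + toℕ (fromℕ L) ≤⟨ increasing⇒spread (toℕ ∘ f) inc (fromℕ L) ⟩
    toℕ (f (fromℕ L))              ≡⟨ larger-after first<last (Equivalence.from (order _ _) σ₀<σₗ) ⟩
    tileEnd t (toℕ (f F.zero))     <⟨ tileEnd-< small (bounded (f F.zero)) ⟩
    toℕ (f F.zero) + L             ∎)
    where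
      open ≤-Reasoning
      first<last : toℕ (f F.zero) < toℕ (f (fromℕ L))
      first<last = inc F.zero (fromℕ L) (subst (0 <_) (sym (toℕ-fromℕ L)) 0<L)
      σ₀<σₗ : lookup (decThenMax (suc L)) F.zero F.< lookup (decThenMax (suc L)) (fromℕ L)
      σ₀<σₗ = subst₂ _<_ (sym (toℕ-lookup-decThenMax-inject₁ L F.zero))
                         (sym (toℕ-lookup-decThenMax-last L)) (n<1+n K)

Avoider : ∀ {n} → ℕ → Vec (Fin n) n → Set
Avoider L π = IsPermutation π × Avoids π p123 × Avoids π p132 × Avoids π (decThenMax (suc L))

ValidTiling : ℕ → ℕ → List ℕ → Set
ValidTiling L n t = TileSizes L t × sum t ≡ n

run-bound : ∀ {K c} {g : ℕ → ℕ} → (∀ {q} → q < K → suc (q + g q) ≡ c) → K ≤ c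
run-bound {zero}          _   = z≤n
run-bound {suc K} {g = g} run = ≤-trans (s≤s (m≤m+n K (g K))) (≤-reflexive (run (n<1+n K)))

run-value : ∀ {j K c x} → j < K → K ≤ c → suc (j + x) ≡ c → x ≡ (c ∸ K) + (K ∸ suc j)
run-value {j} {K} {c} {x} j<K K≤c c≡ = begin
  x                     ≡⟨ m+n∸m≡n (suc j) x ⟨
  suc (j + x) ∸ suc j   ≡⟨ cong (_∸ suc j) c≡ ⟩
  c ∸ suc j             ≡⟨ cong (_∸ suc j) (m∸n+n≡m K≤c) ⟨
  (c ∸ K) + K ∸ suc j   ≡⟨ +-∸-assoc (c ∸ K) j<K ⟩
  (c ∸ K) + (K ∸ suc j) ∎
  where open ≡-Reasoning

module FromAvoider {n K} {π : Vec (Fin n) n} (avoider : Avoider K π) where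

  p : ℕ → ℕ
  p = toFun π

  perm : IsPermutation π
  perm = proj₁ avoider

  avoids123 : Avoids π p123
  avoids123 = proj₁ (proj₂ avoider)

  avoids132 : Avoids π p132
  avoids132 = proj₁ (proj₂ (proj₂ avoider))

  avoidsDecThenMax : Avoids π (decThenMax (suc K))
  avoidsDecThenMax = proj₂ (proj₂ (proj₂ avoider))

  injectiveBelow : InjectiveBelow n p
  injectiveBelow {i} {j} i<n j<n eq = begin
    i                   ≡⟨ toℕ-fromℕ< i<n ⟨
    toℕ (fromℕ< i<n)    ≡⟨ cong toℕ (perm _ _ (toℕ-injective (begin
                             toℕ (lookup π (fromℕ< i<n)) ≡⟨ toFun-< π i<n ⟨
                             p i                         ≡⟨ eq ⟩
                             p j                         ≡⟨ toFun-< π j<n ⟩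
                             toℕ (lookup π (fromℕ< j<n)) ∎))) ⟩
    toℕ (fromℕ< j<n)    ≡⟨ toℕ-fromℕ< j<n ⟩
    j                   ∎
    where open ≡-Reasoning

  segment : IsSegmentPermutation p 0 n
  segment = record { bounded = bounded ; onto = onto }
    where
      bounded : ∀ {i} → i < n → p i < n
      bounded i<n = subst (_< n) (sym (toFun-< π i<n)) (toℕ<n _)
      onto : ∀ {v} → v < n → ∃[ i ] i < n × p i ≡ v
      onto v<n with injective⇒surjective (lookup π) perm (fromℕ< v<n)
      ... | x , πx≡v = toℕ x , toℕ<n x , trans (toFun-toℕ π x) (trans (cong toℕ πx≡v) (toℕ-fromℕ< v<n))

  triple⇒contains : ∀ {i j l} → i < j → j < l → l < n → (σ : Vec (Fin 3) 3) {x y z : ℕ} →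
                    x < y → y < z →
                    (∀ a → p (lookup (i ∷ j ∷ l ∷ []) a) ≡ lookup (x ∷ y ∷ z ∷ []) (lookup σ a)) →
                    Contains π σ
  triple⇒contains i<j j<l l<n σ x<y y<z agree =
    embedding⇒contains π σ _ _ bounded (lookup₃-increasing i<j j<l) (lookup₃-increasing x<y y<z) agree
    where
      bounded = λ { F.zero → <-trans i<j (<-trans j<l l<n) ; (F.suc F.zero) → <-trans j<l l<n
                  ; (F.suc (F.suc F.zero)) → l<n }

  oneLargerAfter : AtMostOneLargerAfter n p
  oneLargerAfter {i} {j} {l} i<j j<l l<n pi<pj pi<pl with <-cmp (p j) (p l)
  ... | tri< pj<pl _ _ = avoids123 (triple⇒contains i<j j<l l<n p123 pi<pj pj<pl
                      λ { F.zero → refl ; (F.suc F.zero) → refl ; (F.suc (F.suc F.zero)) → refl })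
  ... | tri≈ _ pj≡pl _ = <-irrefl (injectiveBelow (<-trans j<l l<n) l<n pj≡pl) j<l
  ... | tri> _ _ pl<pj = avoids132 (triple⇒contains i<j j<l l<n p132 pi<pl pl<pj
                      λ { F.zero → refl ; (F.suc F.zero) → refl ; (F.suc (F.suc F.zero)) → refl })

  noTopAfterRun : NoTopAfterRun K n p
  noTopAfterRun {s} {l} {c} s+K≤l l<n run p[l]≡c =
    avoidsDecThenMax (embedding⇒contains π σ f h f<n f-inc h-inc agree)
    where
      σ = decThenMax (suc K)

      K≤c : K ≤ c
      K≤c = run-bound {g = λ q → p (s + q)} run

      f : Fin (suc K) → ℕ
      f a with lastView a
      ... | last     = l
      ... | inject j = s + toℕ j

      -- σ is K-1, …, 0, K; shifted up by c - K it becomes the run followed by c.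
      h : Fin (suc K) → ℕ
      h v = (c ∸ K) + toℕ v

      run<l : ∀ (j : Fin K) → s + toℕ j < l
      run<l j = <-≤-trans (+-monoʳ-< s (toℕ<n j)) s+K≤l

      f<n : ∀ a → f a < n
      f<n a with lastView a
      ... | last     = l<n
      ... | inject j = <-trans (run<l j) l<n

      f-inc : StrictlyIncreasing f
      f-inc a b a<b with lastView a | lastView b
      ... | inject j | inject j′ = +-monoʳ-< s (subst₂ _<_ (toℕ-inject₁ j) (toℕ-inject₁ j′) a<b)
      ... | inject j | last      = run<l j
      ... | last     | inject j′ =
        ⊥-elim (<-asym (subst₂ _<_ (toℕ-fromℕ K) (toℕ-inject₁ j′) a<b) (toℕ<n j′))
      ... | last     | last      = ⊥-elim (<-irrefl refl a<b)

      h-inc : StrictlyIncreasing h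
      h-inc a b = +-monoʳ-< (c ∸ K)

      agree : ∀ a → p (f a) ≡ h (lookup σ a)
      agree a with lastView a
      ... | last     = trans p[l]≡c
                         (sym (trans (cong ((c ∸ K) +_) (toℕ-lookup-decThenMax-last K)) (m∸n+n≡m K≤c)))
      ... | inject j = trans (run-value (toℕ<n j) K≤c (run (toℕ<n j)))
                             (cong ((c ∸ K) +_) (sym (toℕ-lookup-decThenMax-inject₁ K j)))

  isTilingPerm : IsTilingPermOn K p 0 n
  isTilingPerm = Structure.decompose injectiveBelow oneLargerAfter noTopAfterRun
                                     (<-wellFounded n) refl segment

  t : List ℕ
  t = proj₁ isTilingPerm

  sizes : TileSizes K t
  sizes = proj₁ (proj₂ isTilingPerm)

  sum≡n : sum t ≡ n
  sum≡n = proj₁ (proj₂ (proj₂ isTilingPerm))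

  agree : ∀ {i} → i < n → p i ≡ tilingPerm t i
  agree = proj₂ (proj₂ (proj₂ isTilingPerm))

  decode≡t : decode p n ≡ t
  decode≡t = subst (λ m → runLengths (endsTile? p n) 0 m 0 ≡ t) sum≡n
                   (decode-tilingPerm {p} (All.map proj₁ sizes) sum≡n (agree ∘ subst (_ <_) sum≡n))

  fromTiling-decode : fromTiling n (decode p n) ≡ π
  fromTiling-decode = begin
    fromTiling n (decode p n) ≡⟨ cong (fromTiling n) decode≡t ⟩
    fromTiling n t            ≡⟨ tabulate-cong pointwise ⟩
    tabulate (lookup π)       ≡⟨ tabulate∘lookup π ⟩
    π                         ∎
    where
      open ≡-Reasoning
      open FromTiling (All.map proj₁ sizes) sum≡n using (toℕ-lookup-fromTiling)
      pointwise : ∀ x → fromℕ-or (tilingPerm t (toℕ x)) x ≡ lookup π x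
      pointwise x = toℕ-injective (begin
        toℕ (fromℕ-or (tilingPerm t (toℕ x)) x)      ≡⟨ cong toℕ (lookup∘tabulate _ x) ⟨
        toℕ (lookup (fromTiling n t) x)             ≡⟨ toℕ-lookup-fromTiling x ⟩
        tilingPerm t (toℕ x)                        ≡⟨ agree (toℕ<n x) ⟨
        p (toℕ x)                                   ≡⟨ toFun-toℕ π x ⟩
        toℕ (lookup π x)                            ∎)

  decode-valid : ValidTiling K n (decode p n)
  decode-valid = subst (ValidTiling K n) (sym decode≡t) (sizes , sum≡n)

fromTiling-avoider : ∀ {n L t} → 0 < L → ValidTiling L n t → Avoider L (fromTiling n t)
fromTiling-avoider 0<L (sizes , sum≡n) =
  isPermutation , avoids-firstSmallest p123 z<s z<s , avoids-firstSmallest p132 z<s z<s ,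
  avoids-decThenMax 0<L (All.map proj₂ sizes)
  where open FromTiling (All.map proj₁ sizes) sum≡n

avoiders⤖tilings : ∀ n L → 0 < L → AvoidSet n (suc L) ⤖ Tiling n (suc L)
avoiders⤖tilings n L 0<L = mk⤖ {to = toTiling} (injective , surjective)
  where
    -- The proofs in a refinement are irrelevant, so equations obtained from them are recomputed
    -- with decidable equality.
    toTiling : AvoidSet n (suc L) → Tiling n (suc L)
    toTiling (π , [ avoider ]) = decode (toFun π) n , [ FromAvoider.decode-valid avoider ]

    injective : ∀ {x y} → toTiling x ≡ toTiling y → x ≡ y
    injective {π , [ avoider ]} {π′ , [ avoider′ ]} eq =
      value-injective (recompute (Vecₚ.≡-dec Finₚ._≟_ π π′)
      (trans (sym (FromAvoider.fromTiling-decode avoider))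
             (trans (cong (fromTiling n ∘ value) eq) (FromAvoider.fromTiling-decode avoider′))))

    surjective : ∀ y → ∃[ x ] (∀ {z} → z ≡ x → toTiling z ≡ y)
    surjective (t , [ valid ]) = (fromTiling n t , [ fromTiling-avoider 0<L valid ]) ,
      λ { refl → value-injective (recompute (Listₚ.≡-dec _≟_ _ t)
                   (FromTiling.decode-fromTiling (All.map proj₁ (proj₁ valid)) (proj₂ valid))) }

theorem3p13 : ∀ (n k : ℕ) → 1 ≤ n → 2 ≤ k → AvoidSet n k ⤖ Tiling n k
theorem3p13 n (suc L) _ (s≤s 0<L) = avoiders⤖tilings n L 0<L
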